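{- Let $f\colon\{0,1\}^n\to\{0,1,\perp\}$ be a partial function, $F(x,y)=f(x\oplus y)$, and let $h\colon\{0,1\}^n\to\{0,1\}^t$ be a total function. There exists a total function $\varphi\colon\{0,1\}^t\times\{0,1\}^n\to\{0,1\}$ such that $\varphi(h(x),y)=F(x,y)$ for all $(x,y)\in\operatorname{Dom}(F)$ if and only if $f$ takes the same value on all vertices of each connected component of the partial $h$-induced graph.
   Context: $\operatorname{Dom}(f)=f^{ -1}(\{0,1\})$, $\oplus$ is bitwise XOR, $\operatorname{Dom}(F)=\{(x,y):x\oplus y\in\operatorname{Dom}(f)\}$. A vector $\Delta\in\{0,1\}^n$ is a good shift for $h$ if there exist $x,y\in\{0,1\}^n$ with $x\oplus y=\Delta$ and $h(x)=h(y)$. The total $h$-induced graph has vertex set $\{0,1\}^n$ and an edge between distinct $x,y$ iff $x\oplus y$ is a good shift for $h$. The partial $h$-induced graph is the subgraph of the total $h$-induced graph induced on the vertex set $\operatorname{Dom}(f)$. -}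

module Defs where

open import Data.Bool using (Bool; _xor_)
open import Data.Maybe using (Maybe; just; nothing)
open import Data.Vec using (Vec; zipWith)
open import Data.Nat using (ℕ)
open import Data.Product using (∃; ∃-syntax; _×_)
open import Relation.Binary.PropositionalEquality using (_≡_; _≢_)
open import Relation.Binary.Construct.Closure.ReflexiveTransitive using (Star)

BitVec : ℕ → Set
BitVec n = Vec Bool n

_⊕_ : ∀ {n} → BitVec n → BitVec n → BitVec n
_⊕_ = zipWith _xor_

Partial : ℕ → Set
Partial n = BitVec n → Maybe Bool

InDom : ∀ {n} → Partial n → BitVec n → Set
InDom f x = ∃[ b ] f x ≡ just b

GoodShift : ∀ {n t} → (BitVec n → BitVec t) → BitVec n → Set
GoodShift {n} h Δ = ∃[ x ] ∃[ y ] ((x ⊕ y ≡ Δ) × (h x ≡ h y))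

TotalEdge : ∀ {n t} → (BitVec n → BitVec t) → BitVec n → BitVec n → Set
TotalEdge h x y = (x ≢ y) × GoodShift h (x ⊕ y)

PartialEdge : ∀ {n t} → Partial n → (BitVec n → BitVec t) → BitVec n → BitVec n → Set
PartialEdge f h x y = InDom f x × InDom f y × TotalEdge h x y

SameComponent : ∀ {n t} → Partial n → (BitVec n → BitVec t) → BitVec n → BitVec n → Set
SameComponent f h = Star (PartialEdge f h)

ConstantOnComponents : ∀ {n t} → Partial n → (BitVec n → BitVec t) → Set
ConstantOnComponents {n} f h =
  ∀ (x y : BitVec n) → InDom f x → InDom f y → SameComponent f h x y → f x ≡ f y

Computes : ∀ {n t} → Partial n → (BitVec n → BitVec t) → (BitVec t → BitVec n → Bool) → Set
Computes {n} f h φ = ∀ (x y : BitVec n) (b : Bool) → f (x ⊕ y) ≡ just b → φ (h x) y ≡ b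

-- If φ computes F, then f is constant along every edge: for an edge u — v with
-- u ⊕ v = a ⊕ c and h a = h c, the shift z = a ⊕ u gives a ⊕ z = u and c ⊕ z = v,
-- so f u = φ(h a, z) = φ(h c, z) = f v; constancy on components follows along paths.
-- Conversely, let φ(w, y) = f(x ⊕ y) for any x with h x = w and x ⊕ y ∈ Dom(f).
-- For another such x', the points x ⊕ y and x' ⊕ y differ by the good shift x ⊕ x',
-- so they are equal or adjacent, and f agrees on them.
module Submission where

open import Defs
open import Level using (Level)
open import Data.Nat using (ℕ; zero; suc)
open import Data.Bool using (Bool; true; false)
open import Data.Bool.Properties
  using (_≟_; xor-assoc; xor-comm; xor-same; xor-identityˡ; xor-identityʳ)
open import Data.Maybe using (Maybe; just; nothing)
open import Data.Maybe.Properties using (just-injective)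
open import Data.Vec using ([]; _∷_; replicate)
open import Data.Vec.Properties
  using (≡-dec; map-id; zipWith-assoc; zipWith-comm; zipWith-identityˡ; zipWith-identityʳ; zipWith-inverseˡ)
open import Data.Product using (∃; ∃-syntax; _,_; _×_)
open import Data.Sum using (inj₁; inj₂)
open import Function using (_∘_)
open import Function.Bundles using (_⇔_; mk⇔)
open import Relation.Nullary using (Dec; yes; no; contradiction)
open import Relation.Nullary.Decidable using (map′; _×-dec_; _⊎-dec_)
open import Relation.Unary using (Pred; Decidable)
open import Relation.Binary.PropositionalEquality
  using (_≡_; refl; sym; trans; cong; subst; module ≡-Reasoning)
open import Relation.Binary.Construct.Closure.ReflexiveTransitive using (ε; _◅_; fold)

private
  variable
    p : Level
    n t : ℕ

⊕-assoc : (a b c : BitVec n) → (a ⊕ b) ⊕ c ≡ a ⊕ (b ⊕ c)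
⊕-assoc = zipWith-assoc xor-assoc

⊕-comm : (a b : BitVec n) → a ⊕ b ≡ b ⊕ a
⊕-comm = zipWith-comm xor-comm

⊕-self : (a : BitVec n) → a ⊕ a ≡ replicate n false
⊕-self a = trans (cong (_⊕ a) (sym (map-id a))) (zipWith-inverseˡ xor-same a)

⊕-cancelˡ : (a b : BitVec n) → a ⊕ (a ⊕ b) ≡ b
⊕-cancelˡ a b = begin
  a ⊕ (a ⊕ b)            ≡⟨ sym (⊕-assoc a a b) ⟩
  (a ⊕ a) ⊕ b            ≡⟨ cong (_⊕ b) (⊕-self a) ⟩
  replicate _ false ⊕ b  ≡⟨ zipWith-identityˡ xor-identityˡ b ⟩
  b                      ∎
  where open ≡-Reasoning

⊕-cancelʳ : (a b : BitVec n) → (a ⊕ b) ⊕ b ≡ a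
⊕-cancelʳ a b = begin
  (a ⊕ b) ⊕ b            ≡⟨ ⊕-assoc a b b ⟩
  a ⊕ (b ⊕ b)            ≡⟨ cong (a ⊕_) (⊕-self b) ⟩
  a ⊕ replicate _ false  ≡⟨ zipWith-identityʳ xor-identityʳ a ⟩
  a                      ∎
  where open ≡-Reasoning

⊕-cancel-common : (a b c : BitVec n) → (a ⊕ c) ⊕ (b ⊕ c) ≡ a ⊕ b
⊕-cancel-common a b c = begin
  (a ⊕ c) ⊕ (b ⊕ c)  ≡⟨ cong ((a ⊕ c) ⊕_) (⊕-comm b c) ⟩
  (a ⊕ c) ⊕ (c ⊕ b)  ≡⟨ ⊕-assoc a c (c ⊕ b) ⟩
  a ⊕ (c ⊕ (c ⊕ b))  ≡⟨ cong (a ⊕_) (⊕-cancelˡ c b) ⟩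
  a ⊕ b              ∎
  where open ≡-Reasoning

⊕-shift : (a c u v : BitVec n) → a ⊕ c ≡ u ⊕ v → c ⊕ (a ⊕ u) ≡ v
⊕-shift a c u v a⊕c≡u⊕v = begin
  c ⊕ (a ⊕ u)  ≡⟨ sym (⊕-assoc c a u) ⟩
  (c ⊕ a) ⊕ u  ≡⟨ cong (_⊕ u) (trans (⊕-comm c a) a⊕c≡u⊕v) ⟩
  (u ⊕ v) ⊕ u  ≡⟨ cong (_⊕ u) (⊕-comm u v) ⟩
  (v ⊕ u) ⊕ u  ≡⟨ ⊕-cancelʳ v u ⟩
  v            ∎
  where open ≡-Reasoning

bitVec-any? : {P : Pred (BitVec n) p} → Decidable P → Dec (∃ P)
bitVec-any? {zero} P? = map′ ([] ,_) (λ { ([] , p) → p }) (P? [])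
bitVec-any? {suc n} P? =
  map′ (λ { (inj₁ (v , p)) → true ∷ v , p ; (inj₂ (v , p)) → false ∷ v , p })
       (λ { (true ∷ v , p) → inj₁ (v , p) ; (false ∷ v , p) → inj₂ (v , p) })
       (bitVec-any? (P? ∘ (true ∷_)) ⊎-dec bitVec-any? (P? ∘ (false ∷_)))

isJust? : (m : Maybe Bool) → Dec (∃[ b ] m ≡ just b)
isJust? (just b) = yes (b , refl)
isJust? nothing  = no λ ()

module _ (f : Partial n) (h : BitVec n → BitVec t) where

  computes⇒edge-preserving : ∀ φ → Computes f h φ →
    ∀ {u v} → PartialEdge f h u v → f u ≡ f v
  computes⇒edge-preserving φ computes {u} {v}
    ((b₁ , fu≡b₁) , (b₂ , fv≡b₂) , _ , a , c , a⊕c≡u⊕v , ha≡hc) = begin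
      f u                    ≡⟨ fu≡b₁ ⟩
      just b₁                ≡⟨ cong just (sym (computes a z b₁ fa⊕z≡b₁)) ⟩
      just (φ (h a) z)       ≡⟨ cong (λ w → just (φ w z)) ha≡hc ⟩
      just (φ (h c) z)       ≡⟨ cong just (computes c z b₂ fc⊕z≡b₂) ⟩
      just b₂                ≡⟨ sym fv≡b₂ ⟩
      f v                    ∎
    where
    open ≡-Reasoning
    z = a ⊕ u
    fa⊕z≡b₁ : f (a ⊕ z) ≡ just b₁
    fa⊕z≡b₁ = trans (cong f (⊕-cancelˡ a u)) fu≡b₁
    fc⊕z≡b₂ : f (c ⊕ z) ≡ just b₂
    fc⊕z≡b₂ = trans (cong f (⊕-shift a c u v a⊕c≡u⊕v)) fv≡b₂

  computes⇒constantOnComponents : ∀ φ → Computes f h φ → ConstantOnComponents f h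
  computes⇒constantOnComponents φ computes _ _ _ _ =
    fold (λ u v → f u ≡ f v) (trans ∘ computes⇒edge-preserving φ computes) refl

  sameFibre⇒sameComponent : ∀ {x x' y} → h x ≡ h x' →
    InDom f (x ⊕ y) → InDom f (x' ⊕ y) → SameComponent f h (x ⊕ y) (x' ⊕ y)
  sameFibre⇒sameComponent {x} {x'} {y} hx≡hx' x⊕y∈Dom x'⊕y∈Dom
    with ≡-dec _≟_ (x ⊕ y) (x' ⊕ y)
  ... | yes same = subst (SameComponent f h (x ⊕ y)) same ε
  ... | no  diff =
    (x⊕y∈Dom , x'⊕y∈Dom , diff , x , x' , sym (⊕-cancel-common x x' y) , hx≡hx') ◅ ε

  Witness : BitVec t → BitVec n → Pred (BitVec n) _
  Witness w y x = h x ≡ w × InDom f (x ⊕ y)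

  witness? : ∀ w y → Decidable (Witness w y)
  witness? w y x = ≡-dec _≟_ (h x) w ×-dec isJust? (f (x ⊕ y))

  decoder : BitVec t → BitVec n → Bool
  decoder w y with bitVec-any? (witness? w y)
  ... | yes (_ , _ , b , _) = b
  ... | no  _               = false

  constantOnComponents⇒computes : ConstantOnComponents f h → Computes f h decoder
  constantOnComponents⇒computes constant x y b fx⊕y≡b
    with bitVec-any? (witness? (h x) y)
  ... | no  none = contradiction (x , refl , b , fx⊕y≡b) none
  ... | yes (x' , hx'≡hx , b' , fx'⊕y≡b') = just-injective (begin
    just b'      ≡⟨ sym fx'⊕y≡b' ⟩
    f (x' ⊕ y)   ≡⟨ constant _ _ x'⊕y∈Dom x⊕y∈Dom
                      (sameFibre⇒sameComponent hx'≡hx x'⊕y∈Dom x⊕y∈Dom) ⟩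
    f (x ⊕ y)    ≡⟨ fx⊕y≡b ⟩
    just b       ∎)
    where
    open ≡-Reasoning
    x⊕y∈Dom : InDom f (x ⊕ y)
    x⊕y∈Dom = b , fx⊕y≡b
    x'⊕y∈Dom : InDom f (x' ⊕ y)
    x'⊕y∈Dom = b' , fx'⊕y≡b'

theorem16 : (n t : ℕ) (f : Partial n) (h : BitVec n → BitVec t) →
    (∃[ φ ] Computes f h φ) ⇔ ConstantOnComponents f h
theorem16 n t f h = mk⇔
  (λ (φ , computes) → computes⇒constantOnComponents f h φ computes)
  (λ constant → decoder f h , constantOnComponents⇒computes f h constant)
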